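{- For every positive integer $n$, $$\Phi^{(2)}[a; bq^n, b'; c, c'; x, y] = \Phi^{(2)}[a; b, b'; c, c'; x, y] + \frac{bx(1-a)}{1-c} \sum_{k=1}^n q^{k-1} \Phi^{(2)}[aq; bq^k, b'; cq, c'; x, y],$$ and $$\Phi^{(2)}[a; bq^{ -n}, b'; c, c'; x, y] = \Phi^{(2)}[a; b, b'; c, c'; x, y] - \frac{bx(1-a)}{1-c} \sum_{k=1}^n q^{ -k} \Phi^{(2)}[aq; bq^{1-k}, b'; cq, c'; x, y].$$
   Context: Let $q$ be a complex number with $|q|<1$. For a complex number $z$ and an integer $N\ge 0$, $(z;q)_N=\prod_{j=0}^{N-1}(1-zq^j)$. The $q$-Appell function $\Phi^{(2)}$ is $$\Phi^{(2)}[a; b, b'; c, c'; x, y] = \sum_{m, n \geq 0} \frac{(a; q)_{m+n} (b; q)_m (b'; q)_n}{(q; q)_m (q; q)_n (c; q)_m (c'; q)_n} x^m y^n .$$ All identities are understood as identities of power series in $x,y$ (convergent for $|x|,|y|$ sufficiently small), with parameters generic so that no denominator appearing vanishes. -}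

module Defs where

open import Level using (Level; _⊔_) renaming (suc to lsuc)
open import Data.Nat using (ℕ; zero; suc) renaming (_+_ to _+ℕ_)
open import Relation.Nullary using (¬_)
open import Algebra.Bundles using (CommutativeRing)

record Field (c ℓ : Level) : Set (lsuc (c ⊔ ℓ)) where
  field
    commutativeRing : CommutativeRing c ℓ
  open CommutativeRing commutativeRing public
  field
    _⁻¹       : Carrier → Carrier
    ⁻¹-inverse : ∀ x → ¬ (x ≈ 0#) → x * (x ⁻¹) ≈ 1#
    0≉1       : ¬ (0# ≈ 1#)

module Series {c ℓ : Level} (F : Field c ℓ) where
  open Field F

  pow : Carrier → ℕ → Carrier
  pow z zero    = 1#
  pow z (suc k) = pow z k * z

  poch : Carrier → Carrier → ℕ → Carrier
  poch q z zero    = 1#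
  poch q z (suc N) = poch q z N * (1# - z * pow q N)

  -- formal power series in two variables x, y: coefficient of x^m y^n
  FPS : Set c
  FPS = ℕ → ℕ → Carrier

  _≋_ : FPS → FPS → Set ℓ
  f ≋ g = ∀ m n → f m n ≈ g m n

  zeroS : FPS
  zeroS m n = 0#

  _⊕_ : FPS → FPS → FPS
  (f ⊕ g) m n = f m n + g m n

  _⊖_ : FPS → FPS → FPS
  (f ⊖ g) m n = f m n - g m n

  _·_ : Carrier → FPS → FPS
  (t · f) m n = t * f m n

  xS : FPS → FPS
  xS f zero    n = 0#
  xS f (suc m) n = f m n

  Σ₁ : ℕ → (ℕ → FPS) → FPS
  Σ₁ zero    f = zeroS
  Σ₁ (suc N) f = Σ₁ N f ⊕ f (suc N)

  Φ2 : (q a b b' c c' : Carrier) → FPS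
  Φ2 q a b b' c c' m n =
    (poch q a (m +ℕ n) * poch q b m * poch q b' n)
    * (poch q q m * poch q q n * poch q c m * poch q c' n) ⁻¹

module Submission where

-- The whole theorem rests on one contiguous relation, valid for every β:
--
--   Φ⁽²⁾[a; βq, b'; c, c'] = Φ⁽²⁾[a; β, b'; c, c']
--                             + β(1-a)/(1-c) · x · Φ⁽²⁾[aq; βq, b'; cq, c'].
--
-- Coefficientwise it follows from (βq;q)_{m+1} = (β;q)_{m+1} + β(1-q^{m+1})(βq;q)_m
-- together with the factorisations (z;q)_{m+1} = (1-z)(zq;q)_m of (a;q)_{m+1+n} and
-- (c;q)_{m+1}: after cancelling the common factor (1-q^{m+1})(1-c) from the
-- denominator, the extra term is exactly a coefficient of Φ⁽²⁾[aq; βq, b'; cq, c'].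
--
-- With β = bqᴺ (resp. β = bq^{-(N+1)}) it is one step from bqᴺ to bq^{N+1}
-- (resp. from bq^{-N} to bq^{-(N+1)}); a telescoping lemma sums the steps, and
-- linearity of x· pulls the common factor b(1-a)/(1-c) out of the sum.

open import Defs
open import Level using (Level)
open import Data.Nat using (ℕ; suc; _∸_)
open import Data.Product using (_×_)
open import Relation.Nullary using (¬_)
open import Data.Nat using (zero) renaming (_+_ to _+ℕ_)
open import Data.Product using (_,_)
open import Data.Maybe using (nothing)

module QAppell {ℓc ℓ : Level} (F : Field ℓc ℓ) where
  open Field F
  open Series F
  open import Relation.Binary.Reasoning.Setoid setoid
  open import Algebra.Properties.Ring ring using (-‿distribʳ-*)
  open import Algebra.Properties.AbelianGroup +-abelianGroup using (⁻¹-∙-comm)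
  open import Algebra.Properties.Group +-group using (ε⁻¹≈ε)
  -- Normalisation of commutative-semiring expressions (negated terms are atoms).
  open import Algebra.Solver.Ring.NaturalCoefficients commutativeSemiring (λ _ _ → nothing)
    using (solve; _:=_; _:+_; _:*_)

  *-nonzero : ∀ {x y} → ¬ (x ≈ 0#) → ¬ (y ≈ 0#) → ¬ (x * y ≈ 0#)
  *-nonzero {x} {y} x≉0 y≉0 xy≈0 = y≉0 (begin
    y                    ≈⟨ *-identityˡ y ⟨
    1# * y               ≈⟨ *-congʳ (trans (*-comm (x ⁻¹) x) (⁻¹-inverse x x≉0)) ⟨
    (x ⁻¹ * x) * y       ≈⟨ *-assoc (x ⁻¹) x y ⟩
    x ⁻¹ * (x * y)       ≈⟨ *-congˡ xy≈0 ⟩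
    x ⁻¹ * 0#            ≈⟨ zeroʳ (x ⁻¹) ⟩
    0#                   ∎)

  -- Cancelling a common factor u of numerator and denominator D ≈ u * E.
  -- (Inversion is not known to respect ≈, so D is kept as given.)
  cancel-common-factor : ∀ {D u E} X → D ≈ u * E → ¬ (D ≈ 0#) → ¬ (E ≈ 0#) →
                         (u * X) * D ⁻¹ ≈ X * E ⁻¹
  cancel-common-factor {D} {u} {E} X D≈uE D≉0 E≉0 = begin
    (u * X) * D ⁻¹                  ≈⟨ *-identityʳ _ ⟨
    ((u * X) * D ⁻¹) * 1#           ≈⟨ *-congˡ (⁻¹-inverse E E≉0) ⟨
    ((u * X) * D ⁻¹) * (E * E ⁻¹)   ≈⟨ solve 5 (λ u X Di E Ei →
                                         ((u :* X) :* Di) :* (E :* Ei) := (X :* Ei) :* ((u :* E) :* Di))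
                                         refl u X (D ⁻¹) E (E ⁻¹) ⟩
    (X * E ⁻¹) * ((u * E) * D ⁻¹)   ≈⟨ *-congˡ (*-congʳ D≈uE) ⟨
    (X * E ⁻¹) * (D * D ⁻¹)         ≈⟨ *-congˡ (⁻¹-inverse D D≉0) ⟩
    (X * E ⁻¹) * 1#                 ≈⟨ *-identityʳ _ ⟩
    X * E ⁻¹                        ∎

  -- 1 - xy = (1 - x) + x(1 - y): the source of the factor 1 - q^{m+1}.
  one-minus-product : ∀ x y → 1# - x * y ≈ (1# - x) + x * (1# - y)
  one-minus-product x y = sym (begin
    (1# - x) + x * (1# - y)        ≈⟨ +-congˡ (distribˡ x 1# (- y)) ⟩
    (1# - x) + (x * 1# + x * - y)  ≈⟨ +-congˡ (+-cong (*-identityʳ x) (sym (-‿distribʳ-* x y))) ⟩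
    (1# - x) + (x - x * y)         ≈⟨ +-assoc 1# (- x) (x - x * y) ⟩
    1# + (- x + (x - x * y))       ≈⟨ +-congˡ (+-assoc (- x) x (- (x * y))) ⟨
    1# + ((- x + x) - x * y)       ≈⟨ +-congˡ (+-congʳ (-‿inverseˡ x)) ⟩
    1# + (0# - x * y)              ≈⟨ +-congˡ (+-identityˡ (- (x * y))) ⟩
    1# - x * y                     ∎)

  xS-⊕ : ∀ f g m n → xS (f ⊕ g) m n ≈ xS f m n + xS g m n
  xS-⊕ f g zero    n = sym (+-identityʳ 0#)
  xS-⊕ f g (suc m) n = refl

  xS-zeroS : ∀ m n → xS zeroS m n ≈ 0#
  xS-zeroS zero    n = refl
  xS-zeroS (suc m) n = refl

  ·-xS-assoc : ∀ s t f → ((s * t) · xS f) ≋ (s · xS (t · f))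
  ·-xS-assoc s t f zero    n = trans (zeroʳ (s * t)) (sym (zeroʳ s))
  ·-xS-assoc s t f (suc m) n = *-assoc s t (f m n)

  ·-congˡ : ∀ {s t} f → s ≈ t → (s · f) ≋ (t · f)
  ·-congˡ f s≈t m n = *-congʳ s≈t

  Σ₁-·-xS : ∀ s (h : ℕ → FPS) N →
            Σ₁ N (λ k → s · xS (h k)) ≋ (s · xS (Σ₁ N h))
  Σ₁-·-xS s h zero    m n = sym (trans (*-congˡ (xS-zeroS m n)) (zeroʳ s))
  Σ₁-·-xS s h (suc N) m n = begin
    Σ₁ N (λ k → s · xS (h k)) m n + s * xS (h (suc N)) m n
      ≈⟨ +-congʳ (Σ₁-·-xS s h N m n) ⟩
    s * xS (Σ₁ N h) m n + s * xS (h (suc N)) m n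
      ≈⟨ distribˡ s _ _ ⟨
    s * (xS (Σ₁ N h) m n + xS (h (suc N)) m n)
      ≈⟨ *-congˡ (xS-⊕ (Σ₁ N h) (h (suc N)) m n) ⟨
    s * xS (Σ₁ (suc N) h) m n ∎

  telescope-up : (f g : ℕ → FPS) → (∀ N → f (suc N) ≋ (f N ⊕ g (suc N))) →
                 ∀ N → f N ≋ (f 0 ⊕ Σ₁ N g)
  telescope-up f g step zero    m n = sym (+-identityʳ (f 0 m n))
  telescope-up f g step (suc N) m n = begin
    f (suc N) m n                          ≈⟨ step N m n ⟩
    f N m n + g (suc N) m n                ≈⟨ +-congʳ (telescope-up f g step N m n) ⟩
    (f 0 m n + Σ₁ N g m n) + g (suc N) m n ≈⟨ +-assoc _ _ _ ⟩
    f 0 m n + Σ₁ (suc N) g m n             ∎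

  telescope-down : (f g : ℕ → FPS) → (∀ N → f N ≋ (f (suc N) ⊕ g (suc N))) →
                   ∀ N → f N ≋ (f 0 ⊖ Σ₁ N g)
  telescope-down f g step zero    m n =
    sym (trans (+-congˡ ε⁻¹≈ε) (+-identityʳ (f 0 m n)))
  telescope-down f g step (suc N) m n = begin
    f (suc N) m n                           ≈⟨ +-identityʳ _ ⟨
    f (suc N) m n + 0#                      ≈⟨ +-congˡ (-‿inverseʳ G) ⟨
    f (suc N) m n + (G - G)                 ≈⟨ +-assoc _ G (- G) ⟨
    (f (suc N) m n + G) - G                 ≈⟨ +-congʳ (step N m n) ⟨
    f N m n - G                             ≈⟨ +-congʳ (telescope-down f g step N m n) ⟩
    (f 0 m n - Σ₁ N g m n) - G              ≈⟨ +-assoc _ _ _ ⟩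
    f 0 m n + (- Σ₁ N g m n - G)            ≈⟨ +-congˡ (⁻¹-∙-comm _ G) ⟩
    f 0 m n - Σ₁ (suc N) g m n              ∎
    where G = g (suc N) m n

  module Pochhammer (q : Carrier) where

    poch-cong : ∀ {z w} → z ≈ w → ∀ N → poch q z N ≈ poch q w N
    poch-cong z≈w zero    = refl
    poch-cong z≈w (suc N) = *-cong (poch-cong z≈w N) (+-congˡ (-‿cong (*-congʳ z≈w)))

    poch-shift : ∀ z k → poch q z (suc k) ≈ (1# - z) * poch q (z * q) k
    poch-shift z zero = begin
      1# * (1# - z * 1#)   ≈⟨ *-identityˡ _ ⟩
      1# - z * 1#          ≈⟨ +-congˡ (-‿cong (*-identityʳ z)) ⟩
      1# - z               ≈⟨ *-identityʳ _ ⟨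
      (1# - z) * 1#        ∎
    poch-shift z (suc k) = begin
      poch q z (suc k) * (1# - z * (pow q k * q))
        ≈⟨ *-congʳ (poch-shift z k) ⟩
      ((1# - z) * poch q (z * q) k) * (1# - z * (pow q k * q))
        ≈⟨ *-congˡ (+-congˡ (-‿cong (solve 3 (λ z u q → z :* (u :* q) := (z :* q) :* u)
                                              refl z (pow q k) q))) ⟩
      ((1# - z) * poch q (z * q) k) * (1# - (z * q) * pow q k)
        ≈⟨ *-assoc _ _ _ ⟩
      (1# - z) * poch q (z * q) (suc k) ∎

    poch-contiguous : ∀ z m → poch q (z * q) (suc m)
                        ≈ poch q z (suc m) + z * (1# - q * pow q m) * poch q (z * q) m
    poch-contiguous z m = begin
      p * (1# - (z * q) * pow q m)
        ≈⟨ *-congˡ (+-congˡ (-‿cong (*-assoc z q (pow q m)))) ⟩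
      p * (1# - z * (q * pow q m))
        ≈⟨ *-congˡ (one-minus-product z (q * pow q m)) ⟩
      p * ((1# - z) + z * w)
        ≈⟨ solve 4 (λ p oz z w → p :* (oz :+ z :* w) := oz :* p :+ z :* w :* p)
                   refl p (1# - z) z w ⟩
      (1# - z) * p + z * w * p
        ≈⟨ +-congʳ (poch-shift z m) ⟨
      poch q z (suc m) + z * w * p ∎
      where
      p = poch q (z * q) m
      w = 1# - q * pow q m

    Φ2-congᵇ : ∀ {a β β' b' c c'} → β ≈ β' → Φ2 q a β b' c c' ≋ Φ2 q a β' b' c c'
    Φ2-congᵇ β≈β' m n = *-congʳ (*-congʳ (*-congˡ (poch-cong β≈β' m)))

  module Contiguity (q a b' c c' : Carrier)
    (q-nonzero  : ∀ m → ¬ (poch q q m ≈ 0#))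
    (c-nonzero  : ∀ m → ¬ (poch q c m ≈ 0#))
    (cq-nonzero : ∀ m → ¬ (poch q (c * q) m ≈ 0#))
    (c'-nonzero : ∀ m → ¬ (poch q c' m ≈ 0#))
    (1-c-nonzero : ¬ (1# - c ≈ 0#)) where

    open Pochhammer q

    ratio : Carrier → Carrier
    ratio β = β * (1# - a) * (1# - c) ⁻¹

    den : Carrier → ℕ → ℕ → Carrier
    den γ m n = poch q q m * poch q q n * poch q γ m * poch q c' n

    den-nonzero : ∀ {γ} → (∀ m → ¬ (poch q γ m ≈ 0#)) → ∀ m n → ¬ (den γ m n ≈ 0#)
    den-nonzero γ-nonzero m n =
      *-nonzero (*-nonzero (*-nonzero (q-nonzero m) (q-nonzero n)) (γ-nonzero m)) (c'-nonzero n)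

    den-factor : ∀ m n → den c (suc m) n ≈ ((1# - q * pow q m) * (1# - c)) * den (c * q) m n
    den-factor m n = begin
      (Qm * w) * Qn * poch q c (suc m) * C'    ≈⟨ *-congʳ (*-congˡ (poch-shift c m)) ⟩
      (Qm * w) * Qn * ((1# - c) * Cq) * C'     ≈⟨ solve 6 (λ Qm w Qn oc Cq C' →
                                                     (Qm :* w) :* Qn :* (oc :* Cq) :* C'
                                                       := (w :* oc) :* (Qm :* Qn :* Cq :* C'))
                                                     refl Qm w Qn (1# - c) Cq C' ⟩
      ((w * (1# - c)) * (Qm * Qn * Cq * C'))   ∎
      where
      Qm = poch q q m
      Qn = poch q q n
      w  = 1# - q * pow q m
      Cq = poch q (c * q) m
      C' = poch q c' n

    -- The extra numerator, with the factor (1 - q^{m+1})(1 - c) made explicit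
    -- (using (a;q)_{m+n+1} = (1-a)(aq;q)_{m+n} and (1-c)/(1-c) = 1).
    extra-numerator : ∀ β m n →
      poch q a (suc (m +ℕ n)) * (β * (1# - q * pow q m) * poch q (β * q) m) * poch q b' n
        ≈ ((1# - q * pow q m) * (1# - c))
          * (ratio β * (poch q (a * q) (m +ℕ n) * poch q (β * q) m * poch q b' n))
    extra-numerator β m n = begin
      A * (β * w * p) * B                          ≈⟨ *-congʳ (*-congʳ (poch-shift a (m +ℕ n))) ⟩
      ((1# - a) * α) * (β * w * p) * B             ≈⟨ *-identityʳ _ ⟨
      ((1# - a) * α) * (β * w * p) * B * 1#        ≈⟨ *-congˡ (⁻¹-inverse (1# - c) 1-c-nonzero) ⟨
      ((1# - a) * α) * (β * w * p) * B * ((1# - c) * (1# - c) ⁻¹)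
        ≈⟨ solve 8 (λ oa α β w p B oc ic →
                      (oa :* α) :* (β :* w :* p) :* B :* (oc :* ic)
                        := (w :* oc) :* ((β :* oa :* ic) :* (α :* p :* B)))
                   refl (1# - a) α β w p B (1# - c) ((1# - c) ⁻¹) ⟩
      (w * (1# - c)) * (ratio β * (α * p * B))     ∎
      where
      A = poch q a (suc (m +ℕ n))
      α = poch q (a * q) (m +ℕ n)
      w = 1# - q * pow q m
      p = poch q (β * q) m
      B = poch q b' n

    Φ2-step : ∀ β m n →
      Φ2 q a (β * q) b' c c' (suc m) n
        ≈ Φ2 q a β b' c c' (suc m) n + ratio β * Φ2 q (a * q) (β * q) b' (c * q) c' m n
    Φ2-step β m n = begin
      (A * poch q (β * q) (suc m) * B) * D ⁻¹
        ≈⟨ *-congʳ (*-congʳ (*-congˡ (poch-contiguous β m))) ⟩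
      (A * (poch q β (suc m) + β * w * p) * B) * D ⁻¹
        ≈⟨ solve 5 (λ A P X B Di → (A :* (P :+ X) :* B) :* Di
                                     := (A :* P :* B) :* Di :+ (A :* X :* B) :* Di)
                   refl A (poch q β (suc m)) (β * w * p) B (D ⁻¹) ⟩
      (A * poch q β (suc m) * B) * D ⁻¹ + (A * (β * w * p) * B) * D ⁻¹
        ≈⟨ +-congˡ (*-congʳ (extra-numerator β m n)) ⟩
      (A * poch q β (suc m) * B) * D ⁻¹ + ((w * (1# - c)) * (ratio β * N)) * D ⁻¹
        ≈⟨ +-congˡ (cancel-common-factor (ratio β * N) (den-factor m n)
                      (den-nonzero c-nonzero (suc m) n) (den-nonzero cq-nonzero m n)) ⟩
      (A * poch q β (suc m) * B) * D ⁻¹ + (ratio β * N) * E ⁻¹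
        ≈⟨ +-congˡ (*-assoc (ratio β) N (E ⁻¹)) ⟩
      (A * poch q β (suc m) * B) * D ⁻¹ + ratio β * (N * E ⁻¹) ∎
      where
      A = poch q a (suc (m +ℕ n))
      B = poch q b' n
      w = 1# - q * pow q m
      p = poch q (β * q) m
      N = poch q (a * q) (m +ℕ n) * p * B
      D = den c (suc m) n
      E = den (c * q) m n

    contiguous : ∀ {β β'} → β' ≈ β * q →
      Φ2 q a β' b' c c' ≋ (Φ2 q a β b' c c' ⊕ (ratio β · xS (Φ2 q (a * q) β' b' (c * q) c')))
    contiguous {β} e zero n = sym (trans (+-congˡ (zeroʳ (ratio β))) (+-identityʳ _))
    contiguous {β} e (suc m) n = begin
      Φ2 q a _ b' c c' (suc m) n
        ≈⟨ Φ2-congᵇ e (suc m) n ⟩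
      Φ2 q a (β * q) b' c c' (suc m) n
        ≈⟨ Φ2-step β m n ⟩
      Φ2 q a β b' c c' (suc m) n + ratio β * Φ2 q (a * q) (β * q) b' (c * q) c' m n
        ≈⟨ +-congˡ (*-congˡ (Φ2-congᵇ (sym e) m n)) ⟩
      Φ2 q a β b' c c' (suc m) n + ratio β * Φ2 q (a * q) _ b' (c * q) c' m n ∎

    ratio-scale : ∀ b t → ratio (b * t) ≈ ratio b * t
    ratio-scale b t = solve 4 (λ b t oa ic → b :* t :* oa :* ic := b :* oa :* ic :* t)
                              refl b t (1# - a) ((1# - c) ⁻¹)

    contiguous-scaled : ∀ {b t β'} → β' ≈ (b * t) * q →
      Φ2 q a β' b' c c'
        ≋ (Φ2 q a (b * t) b' c c' ⊕ (ratio b · xS (t · Φ2 q (a * q) β' b' (c * q) c')))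
    contiguous-scaled {b} {t} {β'} e m n =
      trans (contiguous e m n)
            (+-congˡ (trans (·-congˡ (xS Φ') (ratio-scale b t) m n) (·-xS-assoc (ratio b) t Φ' m n)))
      where Φ' = Φ2 q (a * q) β' b' (c * q) c'

  module Iteration (q a b b' c c' : Carrier)
    (q≉0 : ¬ (q ≈ 0#))
    (q-nonzero  : ∀ m → ¬ (poch q q m ≈ 0#))
    (c-nonzero  : ∀ m → ¬ (poch q c m ≈ 0#))
    (cq-nonzero : ∀ m → ¬ (poch q (c * q) m ≈ 0#))
    (c'-nonzero : ∀ m → ¬ (poch q c' m ≈ 0#))
    (1-c-nonzero : ¬ (1# - c ≈ 0#)) where

    open Pochhammer q
    open Contiguity q a b' c c' q-nonzero c-nonzero cq-nonzero c'-nonzero 1-c-nonzero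

    Φb : FPS
    Φb = Φ2 q a b b' c c'

    up-term : ℕ → FPS
    up-term k = pow q (k ∸ 1) · Φ2 q (a * q) (b * pow q k) b' (c * q) c'

    down-term : ℕ → FPS
    down-term k = pow (q ⁻¹) k · Φ2 q (a * q) (b * pow (q ⁻¹) (k ∸ 1)) b' (c * q) c'

    up-shift : ∀ N → b * pow q (suc N) ≈ (b * pow q N) * q
    up-shift N = sym (*-assoc b (pow q N) q)

    down-shift : ∀ N → b * pow (q ⁻¹) N ≈ (b * pow (q ⁻¹) (suc N)) * q
    down-shift N = sym (begin
      (b * (t * q ⁻¹)) * q  ≈⟨ *-assoc b (t * q ⁻¹) q ⟩
      b * ((t * q ⁻¹) * q)  ≈⟨ *-congˡ (*-assoc t (q ⁻¹) q) ⟩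
      b * (t * (q ⁻¹ * q))  ≈⟨ *-congˡ (*-congˡ (trans (*-comm (q ⁻¹) q) (⁻¹-inverse q q≉0))) ⟩
      b * (t * 1#)          ≈⟨ *-congˡ (*-identityʳ t) ⟩
      b * t                 ∎)
      where t = pow (q ⁻¹) N

    up : ∀ n → Φ2 q a (b * pow q n) b' c c' ≋ (Φb ⊕ (ratio b · xS (Σ₁ n up-term)))
    up n m k = trans (telescope-up f g step n m k)
                     (+-cong (Φ2-congᵇ (*-identityʳ b) m k) (Σ₁-·-xS (ratio b) up-term n m k))
      where
      f = λ N → Φ2 q a (b * pow q N) b' c c'
      g = λ k → ratio b · xS (up-term k)
      step : ∀ N → f (suc N) ≋ (f N ⊕ g (suc N))
      step N = contiguous-scaled (up-shift N)

    down : ∀ n → Φ2 q a (b * pow (q ⁻¹) n) b' c c' ≋ (Φb ⊖ (ratio b · xS (Σ₁ n down-term)))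
    down n m k = trans (telescope-down f g step n m k)
                       (+-cong (Φ2-congᵇ (*-identityʳ b) m k) (-‿cong (Σ₁-·-xS (ratio b) down-term n m k)))
      where
      f = λ N → Φ2 q a (b * pow (q ⁻¹) N) b' c c'
      g = λ k → ratio b · xS (down-term k)
      step : ∀ N → f N ≋ (f (suc N) ⊕ g (suc N))
      step N = contiguous-scaled (down-shift N)

theorem8 : ∀ {ℓc ℓ : Level} (F : Field ℓc ℓ) →
  let open Field F
      open Series F
  in ∀ (q a b b' c c' : Carrier) →
     ¬ (q ≈ 0#) →
     (∀ m → ¬ (poch q q m ≈ 0#)) →
     (∀ m → ¬ (poch q c m ≈ 0#)) →
     (∀ m → ¬ (poch q (c * q) m ≈ 0#)) →
     (∀ m → ¬ (poch q c' m ≈ 0#)) →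
     ¬ (1# - c ≈ 0#) →
     ∀ (n : ℕ) → 1 Data.Nat.≤ n →
     (Φ2 q a (b * pow q n) b' c c'
        ≋ (Φ2 q a b b' c c'
           ⊕ ((b * (1# - a) * (1# - c) ⁻¹)
              · xS (Σ₁ n (λ k → pow q (k ∸ 1)
                                 · Φ2 q (a * q) (b * pow q k) b' (c * q) c')))))
     ×
     (Φ2 q a (b * pow (q ⁻¹) n) b' c c'
        ≋ (Φ2 q a b b' c c'
           ⊖ ((b * (1# - a) * (1# - c) ⁻¹)
              · xS (Σ₁ n (λ k → pow (q ⁻¹) k
                                 · Φ2 q (a * q) (b * pow (q ⁻¹) (k ∸ 1)) b' (c * q) c')))))
theorem8 F q a b b' c c' q≉0 q-nz c-nz cq-nz c'-nz 1-c≉0 n _ = up n , down n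
  where open QAppell.Iteration F q a b b' c c' q≉0 q-nz c-nz cq-nz c'-nz 1-c≉0
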